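{- Let $n$ be a positive integer, $q=\lfloor n/3\rfloor$, and write $n=3q+r$. Fix $\sigma\in\{\pm1\}^n$ and let $h:=\max\{\mathrm{h}(\sigma),\mathrm{h}(-\sigma)\}$. For any nonnegative integer $i$, if $h\geq q+r+2i-1$, then every bench collection $\beta$ has at least $i$ unbalanced benches, and thus $b(\beta,\sigma)\leq q-i$. In particular, $\nu_{\max}(\sigma)\leq q-i$.
   Context: Drift: for $\sigma\in\{\pm1\}^n$, $\mathrm{h}(\sigma):=\max\left(\{0\}\cup\{\sum_{j=1}^{i}\sigma_j: 1\le i\le n\}\right)$; $-\sigma$ denotes $\sigma$ with every sign changed. Bench collections: with $q=\lfloor n/3\rfloor$, a bench collection $\beta=(B_1,\dots,B_q)$ is a sequence of $q$ pairwise disjoint $3$-element subsets $B_i=\{a_i<b_i<c_i\}\subseteq\{1,\dots,n\}$. Given $\sigma$, bench $B_i$ is balanced if $\sigma_{a_i}+\sigma_{b_i}=0$ and unbalanced otherwise; $b(\beta,\sigma)$ is the number of balanced benches. Napkin problem: a circular table has $n$ seats labelled $1,\dots,n$ (mod $n$), seat $i+1$ immediately to the right of seat $i$; napkin $N_i$ lies between seats $i$ and $i+1$, so the diner in seat $i$ has left napkin $N_{i-1}$ and right napkin $N_i$. Diners $1,\dots,n$ are seated in the order $1,\dots,n$; $\sigma_j=+1$ (resp. $-1$) means Diner $j$ prefers the right (resp. left) napkin. A seated diner takes their preferred napkin if unclaimed, else the other adjacent napkin if unclaimed, else none (napkinless). A seating order is a permutation $w$ of $\{1,\dots,n\}$ with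 $w_1=1$ ($w_i=j$ means Diner $j$ sits in Seat $i$); $\nu(w,\sigma)$ is the number of napkinless diners and $\nu_{\max}(\sigma)=\max_w\nu(w,\sigma)$. -}

module Defs where

open import Data.Nat as ℕ using (ℕ; zero; suc; _/_; _%_)
open import Data.Integer as ℤ using (ℤ; 0ℤ; 1ℤ; -1ℤ; _⊔_)
open import Data.Sign using (Sign; +; -; opposite)
open import Data.Fin as Fin using (Fin; toℕ; fromℕ; inject₁)
open import Data.Fin.Permutation using (Permutation′; _⟨$⟩ʳ_; _⟨$⟩ˡ_)
open import Data.List using (List; []; _∷_; map; foldr; take; upTo; filter; length)
open import Data.List.Base using (allFin)
open import Data.Product using (Σ; _×_; _,_)
open import Data.Sum using (_⊎_)
open import Data.Bool using (Bool; true; false; if_then_else_)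
open import Relation.Nullary using (¬_; Dec; ⌊_⌋)
open import Relation.Binary.PropositionalEquality using (_≡_; _≢_)
open import Function using (_∘_)

-- Positions are 0-based: index k : Fin n corresponds to position k+1 of the paper.

SignVec : ℕ → Set
SignVec n = Fin n → Sign

sgn : Sign → ℤ
sgn + = 1ℤ
sgn - = -1ℤ

negσ : ∀ {n} → SignVec n → SignVec n
negσ σ = opposite ∘ σ

psum : ∀ {n} → SignVec n → ℕ → ℤ
psum {n} σ k = foldr ℤ._+_ 0ℤ (map (sgn ∘ σ) (take k (allFin n)))

drift : ∀ {n} → SignVec n → ℤ
drift {n} σ = foldr _⊔_ 0ℤ (map (psum σ) (map suc (upTo n)))

record Bench (n : ℕ) : Set where
  field
    a b c : Fin n
    a<b : a Fin.< b
    b<c : b Fin.< c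

open Bench public

_∈B_ : ∀ {n} → Fin n → Bench n → Set
x ∈B B = x ≡ a B ⊎ x ≡ b B ⊎ x ≡ c B

record BenchCollection (n : ℕ) : Set where
  field
    bench : Fin (n / 3) → Bench n
    disjoint : ∀ i j → i ≢ j → ∀ x → x ∈B bench i → ¬ (x ∈B bench j)

open BenchCollection public

Balanced : ∀ {n} → SignVec n → Bench n → Set
Balanced σ B = sgn (σ (a B)) ℤ.+ sgn (σ (b B)) ≡ 0ℤ

balanced? : ∀ {n} (σ : SignVec n) (B : Bench n) → Dec (Balanced σ B)
balanced? σ B = (sgn (σ (a B)) ℤ.+ sgn (σ (b B))) ℤ.≟ 0ℤ

numBalanced : ∀ {n} → BenchCollection n → SignVec n → ℕ
numBalanced {n} β σ = length (filter (λ i → balanced? σ (bench β i)) (allFin (n / 3)))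

numUnbalanced : ∀ {n} → BenchCollection n → SignVec n → ℕ
numUnbalanced {n} β σ =
  length (filter (λ i → Relation.Nullary.¬? (balanced? σ (bench β i))) (allFin (n / 3)))
  where import Relation.Nullary

-- Napkin problem, with n = suc m seats/napkins (0-based).
-- Seat s has right napkin N_s and left napkin N_{s-1 mod n}.

leftNapkin : ∀ {m} → Fin (suc m) → Fin (suc m)
leftNapkin {m} Fin.zero = fromℕ m
leftNapkin (Fin.suc s) = inject₁ s

rightNapkin : ∀ {m} → Fin (suc m) → Fin (suc m)
rightNapkin s = s

-- seating order: permutation w with w_1 = 1 (w ⟨$⟩ʳ seat = diner)
SeatingOrder : ℕ → Set
SeatingOrder m = Σ (Permutation′ (suc m)) (λ w → w ⟨$⟩ʳ Fin.zero ≡ Fin.zero)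

claim : ∀ {N} → Fin N → (Fin N → Bool) → Fin N → Bool
claim k f x = if ⌊ x Fin.≟ k ⌋ then true else f x

runDiners : ∀ {m} → Permutation′ (suc m) → SignVec (suc m) →
            List (Fin (suc m)) → (Fin (suc m) → Bool) → ℕ
runDiners w σ [] claimed = 0
runDiners w σ (j ∷ js) claimed =
  let s     = w ⟨$⟩ˡ j
      pref  = prefOf (σ j) s
      other = otherOf (σ j) s
  in if claimed pref
       then (if claimed other
               then suc (runDiners w σ js claimed)
               else runDiners w σ js (claim other claimed))
       else runDiners w σ js (claim pref claimed)
  where
  prefOf : Sign → Fin _ → Fin _
  prefOf + s = rightNapkin s
  prefOf - s = leftNapkin s
  otherOf : Sign → Fin _ → Fin _
  otherOf + s = leftNapkin s
  otherOf - s = rightNapkin s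

ν : ∀ {m} → SeatingOrder m → SignVec (suc m) → ℕ
ν {m} (w , _) σ = runDiners w σ (allFin (suc m)) (λ _ → false)

-- Write N − (σ₁ + ⋯ + σₚ) as a sum of nonnegative weights: 1 − σₓ for x ≤ p and 1 for x > p.
-- Two positions c < j with σ_c = −1 carry weight at least 2 together, so k disjoint such pairs
-- bound every partial sum, hence the drift, by N − 2k. A balanced bench {a < b < c} yields such a
-- pair, c with whichever of a, b is negative, for σ and −σ alike. So does a napkinless diner j:
-- its right napkin went to its right neighbour as a left napkin, either by preference (then that
-- neighbour is negative and closes the pair) or because the neighbour's own right napkin was gone
-- (then repeat). The chain is determined backwards from its end, so distinct napkinless diners get
-- distinct partners; chasing leftwards serves −σ. With h ≥ q + r + 2i − 1 and n = 3q + r, the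
-- bound h ≤ n − 2k forces k ≤ q − i.

module Submission where

open import Defs
open import Data.Nat as ℕ using (ℕ; suc; _/_; _%_; _∸_; _≤_)
open import Data.Integer as ℤ using (ℤ; +_; 1ℤ; _⊔_)
open import Data.Product using (_×_)

import Algebra.Properties.CommutativeSemigroup as CommSemigroupProperties
open import Data.Bool using (Bool; true; false)
open import Data.Empty using (⊥-elim)
open import Data.Fin as Fin using (Fin; zero; suc; toℕ)
import Data.Fin.Properties as FinP
open import Data.Fin.Permutation using (Permutation′; _⟨$⟩ʳ_; _⟨$⟩ˡ_; inverseʳ)
open import Data.Integer using (0ℤ)
import Data.Integer.Properties as ℤP
open import Data.Integer.Tactic.RingSolver using (solve-∀)
open import Data.List using (List; []; _∷_; map; foldr; take; tabulate; filter; length; upTo)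
open import Data.List.Base using (allFin)
open import Data.List.Membership.Propositional using (_∈_; _─_)
open import Data.List.Membership.Propositional.Properties using (∈-allFin)
import Data.List.Properties as ListP
open import Data.List.Relation.Binary.Subset.Propositional using (_⊆_)
open import Data.List.Relation.Unary.All as All using (All; []; _∷_)
import Data.List.Relation.Unary.All.Properties as AllP
open import Data.List.Relation.Unary.AllPairs as AllPairs using (AllPairs; []; _∷_)
import Data.List.Relation.Unary.AllPairs.Properties as AllPairsP
open import Data.List.Relation.Unary.Any using (here; there)
open import Data.List.Relation.Unary.Unique.Propositional using (Unique)
import Data.List.Relation.Unary.Unique.Propositional.Properties as UniqueP
open import Data.Maybe using (Maybe; just; nothing)
open import Data.Maybe.Properties using (just-injective)
open import Data.Nat using (zero; _+_; _*_; z≤n; s≤s)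
open import Data.Nat.DivMod using (m≡m%n+[m/n]*n)
open import Data.Nat.Induction using (<-wellFounded)
open import Data.Nat.ListAction using (sum)
import Data.Nat.Properties as ℕP
import Data.Nat.Tactic.RingSolver as ℕSolver
open import Data.Product using (Σ; ∃; _,_; proj₁; proj₂)
open import Data.Sign as Sign using (Sign; opposite)
open import Data.Sum using (_⊎_; inj₁; inj₂)
open import Function using (_∘_; id; _on_)
open import Induction.WellFounded using (Acc; acc)
open import Relation.Nullary using (Dec; ¬?; yes; no; contradiction)
open import Relation.Binary.PropositionalEquality

∈-─⁺ : ∀ {A : Set} {x z : A} {ys : List A} (x∈ys : x ∈ ys) → z ∈ ys → z ≢ x → z ∈ ys ─ x∈ys
∈-─⁺ (here refl)  (here refl)  z≢x = ⊥-elim (z≢x refl)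
∈-─⁺ (here refl)  (there z∈ys) _   = z∈ys
∈-─⁺ (there x∈ys) (here refl)  _   = here refl
∈-─⁺ (there x∈ys) (there z∈ys) z≢x = there (∈-─⁺ x∈ys z∈ys z≢x)

module _ {A : Set} (f : A → ℕ) where
  open ≡-Reasoning
  open CommSemigroupProperties ℕP.+-commutativeSemigroup using (x∙yz≈y∙xz)

  sum-map-─ : ∀ {x} {ys : List A} (x∈ys : x ∈ ys) →
              sum (map f ys) ≡ f x + sum (map f (ys ─ x∈ys))
  sum-map-─ (here refl) = refl
  sum-map-─ {x} {y ∷ ys} (there x∈ys) = begin
    f y + sum (map f ys)                   ≡⟨ cong (λ n → f y + n) (sum-map-─ x∈ys) ⟩
    f y + (f x + sum (map f (ys ─ x∈ys)))  ≡⟨ x∙yz≈y∙xz (f y) (f x) _ ⟩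
    f x + (f y + sum (map f (ys ─ x∈ys)))  ∎

  sum-map-mono-⊆ : ∀ {xs ys : List A} → Unique xs → xs ⊆ ys →
                   sum (map f xs) ≤ sum (map f ys)
  sum-map-mono-⊆ {[]}     _                 _     = z≤n
  sum-map-mono-⊆ {x ∷ xs} {ys} (x∉xs ∷ xs!) xs⊆ys = ℕP.≤-trans
    (ℕP.+-monoʳ-≤ (f x) (sum-map-mono-⊆ xs! xs⊆ys─x))
    (ℕP.≤-reflexive (sym (sum-map-─ x∈ys)))
    where
    x∈ys : x ∈ ys
    x∈ys = xs⊆ys (here refl)
    xs⊆ys─x : xs ⊆ ys ─ x∈ys
    xs⊆ys─x z∈xs = ∈-─⁺ x∈ys (xs⊆ys (there z∈xs)) (All.lookup x∉xs z∈xs ∘ sym)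

length-filter-¬?+length-filter : ∀ {A : Set} {P : A → Set} (P? : ∀ x → Dec (P x)) xs →
  length (filter (¬? ∘ P?) xs) + length (filter P? xs) ≡ length xs
length-filter-¬?+length-filter P? [] = refl
length-filter-¬?+length-filter P? (x ∷ xs) with P? x
... | yes _ = trans (ℕP.+-suc _ _) (cong suc (length-filter-¬?+length-filter P? xs))
... | no  _ = cong suc (length-filter-¬?+length-filter P? xs)

-- Partial sums as a budget of nonnegative weights

choose : ∀ {A : Set} → Sign → A → A → A
choose Sign.+ x y = x
choose Sign.- x y = y

choose-opposite : ∀ {A : Set} s (x y : A) → choose (opposite s) x y ≡ choose s y x
choose-opposite Sign.+ x y = refl
choose-opposite Sign.- x y = refl

deficit : Sign → ℕ
deficit s = choose s 0 2

sgn+deficit≡1 : ∀ s → sgn s ℤ.+ + deficit s ≡ 1ℤ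
sgn+deficit≡1 Sign.+ = refl
sgn+deficit≡1 Sign.- = refl

weight : ∀ {N} → SignVec N → ℕ → Fin N → ℕ
weight σ zero    _       = 1
weight σ (suc p) zero    = deficit (σ zero)
weight σ (suc p) (suc x) = weight (σ ∘ suc) p x

psum-suc : ∀ {N} (σ : SignVec (suc N)) p → psum σ (suc p) ≡ sgn (σ zero) ℤ.+ psum (σ ∘ suc) p
psum-suc {N} σ p = cong (λ xs → sgn (σ zero) ℤ.+ foldr ℤ._+_ 0ℤ xs) (begin
  map (sgn ∘ σ) (take p (tabulate suc))         ≡⟨ cong (map (sgn ∘ σ) ∘ take p) (sym (ListP.map-tabulate id suc)) ⟩
  map (sgn ∘ σ) (take p (map suc (allFin N)))   ≡⟨ cong (map (sgn ∘ σ)) (ListP.take-map p (allFin N)) ⟩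
  map (sgn ∘ σ) (map suc (take p (allFin N)))   ≡⟨ ListP.map-∘ (take p (allFin N)) ⟨
  map (sgn ∘ σ ∘ suc) (take p (allFin N))       ∎)
  where open ≡-Reasoning

psum+weights≡N : ∀ {N} (σ : SignVec N) p → psum σ p ℤ.+ + sum (tabulate (weight σ p)) ≡ + N
psum+weights≡N {zero}  σ zero    = refl
psum+weights≡N {zero}  σ (suc p) = refl
psum+weights≡N {suc N} σ zero    = cong (λ z → 1ℤ ℤ.+ z) (psum+weights≡N (σ ∘ suc) zero)
psum+weights≡N {suc N} σ (suc p) = begin
  psum σ (suc p) ℤ.+ + (deficit s + W)          ≡⟨ cong₂ ℤ._+_ (psum-suc σ p) (ℤP.pos-+ (deficit s) W) ⟩
  (sgn s ℤ.+ psum σ′ p) ℤ.+ (+ deficit s ℤ.+ + W) ≡⟨ interchange (sgn s) _ _ _ ⟩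
  (sgn s ℤ.+ + deficit s) ℤ.+ (psum σ′ p ℤ.+ + W) ≡⟨ cong₂ ℤ._+_ (sgn+deficit≡1 s) (psum+weights≡N σ′ p) ⟩
  1ℤ ℤ.+ + N                                     ∎
  where
  open ≡-Reasoning
  open CommSemigroupProperties ℤP.+-commutativeSemigroup using (interchange)
  s : Sign
  s = σ zero
  σ′ : SignVec N
  σ′ = σ ∘ suc
  W : ℕ
  W = sum (tabulate (weight σ′ p))

descent-weight : ∀ {N} (σ : SignVec N) p {j c : Fin N} → c Fin.< j → σ c ≡ Sign.- →
                 2 ≤ weight σ p j + weight σ p c
descent-weight σ zero    _ _ = ℕP.≤-refl
descent-weight σ (suc p) {suc j} {zero}  _         σc≡- rewrite σc≡- = ℕP.m≤n+m 2 _
descent-weight σ (suc p) {suc j} {suc c} (s≤s c<j) σc≡- = descent-weight (σ ∘ suc) p c<j σc≡-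

-- Matchings bound the drift

endpoints : ∀ {A : Set} → List (A × A) → List A
endpoints []             = []
endpoints ((x , y) ∷ ps) = x ∷ y ∷ endpoints ps

Descent : ∀ {N} → SignVec N → Fin N × Fin N → Set
Descent σ (j , c) = c Fin.< j × σ c ≡ Sign.-

record Matching {N} (σ : SignVec N) (k : ℕ) : Set where
  field
    pairs    : List (Fin N × Fin N)
    size     : length pairs ≡ k
    descents : All (Descent σ) pairs
    unique   : Unique (endpoints pairs)

module _ {N} (σ : SignVec N) (p : ℕ) where

  descents-weight : ∀ {ps} → All (Descent σ) ps → 2 * length ps ≤ sum (map (weight σ p) (endpoints ps))
  descents-weight []                          = z≤n
  descents-weight {(j , c) ∷ ps} ((c<j , σc≡-) ∷ ds) = begin
    2 * suc (length ps)                                 ≡⟨ ℕP.*-suc 2 (length ps) ⟩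
    2 + 2 * length ps                                   ≤⟨ ℕP.+-mono-≤ (descent-weight σ p c<j σc≡-) (descents-weight ds) ⟩
    (weight σ p j + weight σ p c) + sum (map (weight σ p) (endpoints ps)) ≡⟨ ℕP.+-assoc (weight σ p j) _ _ ⟩
    sum (map (weight σ p) (endpoints ((j , c) ∷ ps)))  ∎
    where open ℕP.≤-Reasoning

  psum-≤-matching : ∀ {k} → Matching σ k → psum σ p ℤ.≤ + N ℤ.- + (2 * k)
  psum-≤-matching {k} M = subst (ℤ._≤ + N ℤ.- + (2 * k)) psum≡N-W
    (ℤP.+-monoʳ-≤ (+ N) (ℤP.neg-mono-≤ (ℤ.+≤+ 2k≤W)))
    where
    open Matching M
    W : ℕ
    W = sum (tabulate (weight σ p))
    2k≤W : 2 * k ≤ W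
    2k≤W = ℕP.≤-trans (subst (λ n → 2 * n ≤ _) size (descents-weight descents))
      (subst (sum (map (weight σ p) (endpoints pairs)) ≤_) (cong sum (ListP.map-tabulate id (weight σ p)))
        (sum-map-mono-⊆ (weight σ p) unique (λ {x} _ → ∈-allFin x)))
    a+b-b≡a : ∀ (a b : ℤ) → (a ℤ.+ b) ℤ.- b ≡ a
    a+b-b≡a = solve-∀
    psum≡N-W : + N ℤ.- + W ≡ psum σ p
    psum≡N-W = trans (cong (ℤ._- + W) (sym (psum+weights≡N σ p))) (a+b-b≡a (psum σ p) (+ W))

-- The empty prefix makes psum σ 0 = 0 the base case of the maximum.
drift-lub : ∀ {N} (σ : SignVec N) {D} → (∀ p → psum σ p ℤ.≤ D) → drift σ ℤ.≤ D
drift-lub {N} σ {D} bound = foldr-lub (map suc (upTo N))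
  where
  foldr-lub : ∀ ps → foldr _⊔_ 0ℤ (map (psum σ) ps) ℤ.≤ D
  foldr-lub []       = bound 0
  foldr-lub (p ∷ ps) = ℤP.⊔-lub (bound p) (foldr-lub ps)

drift-≤-matching : ∀ {N k} {σ : SignVec N} → Matching σ k → drift σ ℤ.≤ + N ℤ.- + (2 * k)
drift-≤-matching {σ = σ} M = drift-lub σ (λ p → psum-≤-matching σ p M)

module _ {ι A : Set} (f g : ι → A) where

  Apart : ι → ι → Set
  Apart i j = f i ≢ f j × f i ≢ g j × g i ≢ f j × g i ≢ g j

  All-endpoints : ∀ {P : A → Set} {I} → All (λ i → P (f i) × P (g i)) I →
                  All P (endpoints (map (λ i → f i , g i) I))
  All-endpoints []                 = []
  All-endpoints ((pf , pg) ∷ ps) = pf ∷ pg ∷ All-endpoints ps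

  endpoints-unique : ∀ {I} → All (λ i → f i ≢ g i) I → AllPairs Apart I →
                     Unique (endpoints (map (λ i → f i , g i) I))
  endpoints-unique []             []           = []
  endpoints-unique (fi≢gi ∷ ne) (apart ∷ aps) =
    (fi≢gi ∷ All-endpoints (All.map (λ (ff , fg , _ , _) → ff , fg) apart))
    ∷ All-endpoints (All.map (λ (_ , _ , gf , gg) → gf , gg) apart)
    ∷ endpoints-unique ne aps

-- Balanced benches

Opposed : ∀ {N} → SignVec N → Bench N → Set
Opposed σ B = σ (b B) ≡ opposite (σ (a B))

sgn-sum≡0⇒opposite : ∀ s t → sgn s ℤ.+ sgn t ≡ 0ℤ → t ≡ opposite s
sgn-sum≡0⇒opposite Sign.+ Sign.- _ = refl
sgn-sum≡0⇒opposite Sign.- Sign.+ _ = refl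
sgn-sum≡0⇒opposite Sign.+ Sign.+ ()
sgn-sum≡0⇒opposite Sign.- Sign.- ()

balanced⇒opposed : ∀ {N} (σ : SignVec N) B → Balanced σ B → Opposed σ B
balanced⇒opposed σ B = sgn-sum≡0⇒opposite (σ (a B)) (σ (b B))

negativeEnd : ∀ {N} → SignVec N → Bench N → Fin N
negativeEnd σ B = choose (σ (a B)) (b B) (a B)

module _ {N} (σ : SignVec N) (B : Bench N) where

  negativeEnd-sign : Opposed σ B → σ (negativeEnd σ B) ≡ Sign.-
  negativeEnd-sign opp with σ (a B) in σa
  ... | Sign.+ = opp
  ... | Sign.- = σa

  negativeEnd<c : negativeEnd σ B Fin.< c B
  negativeEnd<c with σ (a B)
  ... | Sign.+ = b<c B
  ... | Sign.- = ℕP.<-trans (a<b B) (b<c B)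

  negativeEnd∈B : negativeEnd σ B ∈B B
  negativeEnd∈B with σ (a B)
  ... | Sign.+ = inj₂ (inj₁ refl)
  ... | Sign.- = inj₁ refl

module _ {N} (β : BenchCollection N) where

  ∈B-apart : ∀ {i j x y} → i ≢ j → x ∈B bench β i → y ∈B bench β j → x ≢ y
  ∈B-apart i≢j x∈i y∈j refl = disjoint β _ _ i≢j _ x∈i y∈j

  opposedMatching : (σ : SignVec N) {I : List (Fin (N / 3))} → Unique I →
                    All (Opposed σ ∘ bench β) I → Matching σ (length I)
  opposedMatching σ {I} I! opposed = record
    { pairs    = map (λ i → c (bench β i) , negativeEnd σ (bench β i)) I
    ; size     = ListP.length-map _ I
    ; descents = AllP.map⁺ (All.map (λ {i} opp →
                   negativeEnd<c σ (bench β i) , negativeEnd-sign σ (bench β i) opp) opposed)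
    ; unique   = endpoints-unique _ _
                   (All.universal (λ i c≡end → ℕP.<⇒≢ (negativeEnd<c σ (bench β i)) (cong toℕ (sym c≡end))) I)
                   (AllPairs.map apart I!)
    }
    where
    c∈B : ∀ i → c (bench β i) ∈B bench β i
    c∈B i = inj₂ (inj₂ refl)
    apart : ∀ {i j} → i ≢ j → Apart (λ i → c (bench β i)) (λ i → negativeEnd σ (bench β i)) i j
    apart {i} {j} i≢j =
        ∈B-apart i≢j (c∈B i) (c∈B j)
      , ∈B-apart i≢j (c∈B i) (negativeEnd∈B σ (bench β j))
      , ∈B-apart i≢j (negativeEnd∈B σ (bench β i)) (c∈B j)
      , ∈B-apart i≢j (negativeEnd∈B σ (bench β i)) (negativeEnd∈B σ (bench β j))

  balancedMatching : (σ : SignVec N) {σ′ : SignVec N} → (∀ {B} → Balanced σ B → Opposed σ′ B) →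
                     Matching σ′ (numBalanced β σ)
  balancedMatching σ {σ′} balanced⇒ = opposedMatching σ′
    (UniqueP.filter⁺ balanced?ᵢ (UniqueP.allFin⁺ (N / 3)))
    (All.map (λ {i} → balanced⇒ {bench β i}) (AllP.all-filter balanced?ᵢ (allFin (N / 3))))
    where
    balanced?ᵢ : ∀ i → Dec (Balanced σ (bench β i))
    balanced?ᵢ i = balanced? σ (bench β i)

unbalanced+balanced : ∀ {N} (β : BenchCollection N) σ → numUnbalanced β σ + numBalanced β σ ≡ N / 3
unbalanced+balanced {N} β σ =
  trans (length-filter-¬?+length-filter (λ i → balanced? σ (bench β i)) (allFin (N / 3)))
        (ListP.length-tabulate id)

-- Napkinless diners

data Outcome : Set where
  preferred other napkinless : Outcome

outcome : Bool → Bool → Outcome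
outcome false _     = preferred
outcome true  false = other
outcome true  true  = napkinless

missed : Outcome → ℕ
missed preferred  = 0
missed other      = 0
missed napkinless = 1

outcome≡napkinless : ∀ {x y} → outcome x y ≡ napkinless → x ≡ true × y ≡ true
outcome≡napkinless {true} {true} _ = refl , refl

outcome≡other : ∀ {x y} → outcome x y ≡ other → x ≡ true
outcome≡other {true} _ = refl

choose-both : ∀ {A : Set} {P : A → Set} s {x y} → P x → P y → P (choose s x y)
choose-both Sign.+ px _  = px
choose-both Sign.- _  py = py

takenNapkin : ∀ {A : Set} → Outcome → A → A → Maybe A
takenNapkin preferred  x _ = just x
takenNapkin other      _ y = just y
takenNapkin napkinless _ _ = nothing

grab : ∀ {N} → Maybe (Fin N) → (Fin N → Bool) → (Fin N → Bool)
grab nothing  claimed = claimed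
grab (just x) claimed = claim x claimed

grab-claimed : ∀ {N} mx (claimed : Fin N → Bool) x →
               grab mx claimed x ≡ true → claimed x ≡ true ⊎ mx ≡ just x
grab-claimed nothing  _       _ h = inj₁ h
grab-claimed (just y) claimed x h with x Fin.≟ y
... | yes refl = inj₂ refl
... | no  _    = inj₁ h

leftNapkin-injective : ∀ {m} {x y : Fin (suc m)} → leftNapkin x ≡ leftNapkin y → x ≡ y
leftNapkin-injective {x = zero}  {zero}  _ = refl
leftNapkin-injective {x = zero}  {suc y} e = ⊥-elim (FinP.fromℕ≢inject₁ e)
leftNapkin-injective {x = suc x} {zero}  e = ⊥-elim (FinP.fromℕ≢inject₁ (sym e))
leftNapkin-injective {x = suc x} {suc y} e = cong suc (FinP.inject₁-injective e)

module Dinner {m} (w : Permutation′ (suc m)) (σ : SignVec (suc m)) where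

  Claims : Set
  Claims = Fin (suc m) → Bool

  seat : Fin (suc m) → Fin (suc m)
  seat j = w ⟨$⟩ˡ j

  seat-injective : ∀ {j k} → seat j ≡ seat k → j ≡ k
  seat-injective e = trans (sym (inverseʳ w)) (trans (cong (w ⟨$⟩ʳ_) e) (inverseʳ w))

  preferredNapkin otherNapkin : Fin (suc m) → Fin (suc m)
  preferredNapkin j = choose (σ j) (rightNapkin (seat j)) (leftNapkin (seat j))
  otherNapkin     j = choose (σ j) (leftNapkin (seat j)) (rightNapkin (seat j))

  outcomeIn : Claims → Fin (suc m) → Outcome
  outcomeIn claimed j = outcome (claimed (preferredNapkin j)) (claimed (otherNapkin j))

  napkinTaken : Outcome → Fin (suc m) → Maybe (Fin (suc m))
  napkinTaken o j = takenNapkin o (preferredNapkin j) (otherNapkin j)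

  sit : Fin (suc m) → Claims → Claims
  sit j claimed = grab (napkinTaken (outcomeIn claimed j) j) claimed

  runDiners-∷ : ∀ j js claimed →
    runDiners w σ (j ∷ js) claimed ≡ missed (outcomeIn claimed j) + runDiners w σ js (sit j claimed)
  runDiners-∷ j js claimed with σ j
  ... | Sign.+ with claimed (seat j) | claimed (leftNapkin (seat j))
  ...   | true  | true  = refl
  ...   | true  | false = refl
  ...   | false | _     = refl
  runDiners-∷ j js claimed | Sign.- with claimed (leftNapkin (seat j)) | claimed (seat j)
  ...   | true  | true  = refl
  ...   | true  | false = refl
  ...   | false | _     = refl

  claimsBefore : ∀ {k} → (Fin k → Fin (suc m)) → Claims → Fin k → Claims
  claimsBefore f claimed zero    = claimed
  claimsBefore f claimed (suc i) = claimsBefore (f ∘ suc) (sit (f zero) claimed) i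

  NapkinlessIn : ∀ {k} → (Fin k → Fin (suc m)) → Claims → Fin k → Set
  NapkinlessIn f claimed i = outcomeIn (claimsBefore f claimed i) (f i) ≡ napkinless

  NapkinlessList : ∀ {k} → (Fin k → Fin (suc m)) → Claims → Set
  NapkinlessList f claimed = Σ (List (∃ (NapkinlessIn f claimed))) λ Zs →
    AllPairs (_≢_ on proj₁) Zs × length Zs ≡ runDiners w σ (tabulate f) claimed

  napkinlessList : ∀ {k} (f : Fin k → Fin (suc m)) claimed → NapkinlessList f claimed
  napkinlessList {zero}  f claimed = [] , [] , refl
  napkinlessList {suc k} f claimed with napkinlessList (f ∘ suc) (sit (f zero) claimed)
  ... | Zs , Zs! , len = extend (outcomeIn claimed (f zero)) refl
    where
    shift : ∃ (NapkinlessIn (f ∘ suc) (sit (f zero) claimed)) → ∃ (NapkinlessIn f claimed)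
    shift (i , nl) = suc i , nl
    shifted! : AllPairs (_≢_ on proj₁) (map shift Zs)
    shifted! = AllPairsP.map⁺ (AllPairs.map (λ i≢j → i≢j ∘ FinP.suc-injective) Zs!)
    counted : ∀ o → outcomeIn claimed (f zero) ≡ o →
              missed o + length (map shift Zs) ≡ runDiners w σ (tabulate f) claimed
    counted o eq = begin
      missed o + length (map shift Zs)
        ≡⟨ cong₂ _+_ (cong missed (sym eq)) (trans (ListP.length-map shift Zs) len) ⟩
      missed (outcomeIn claimed (f zero)) + runDiners w σ (tabulate (f ∘ suc)) (sit (f zero) claimed)
        ≡⟨ runDiners-∷ (f zero) (tabulate (f ∘ suc)) claimed ⟨
      runDiners w σ (tabulate f) claimed ∎
      where open ≡-Reasoning
    extend : ∀ o → outcomeIn claimed (f zero) ≡ o → NapkinlessList f claimed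
    extend preferred  eq = map shift Zs , shifted! , counted preferred eq
    extend other      eq = map shift Zs , shifted! , counted other eq
    extend napkinless eq = (zero , eq) ∷ map shift Zs
                         , AllP.map⁺ (All.universal (λ _ ()) Zs) ∷ shifted!
                         , counted napkinless eq

  claimsBefore-taken : ∀ {k} (f : Fin k → Fin (suc m)) claimed i x → claimsBefore f claimed i x ≡ true →
    claimed x ≡ true ⊎
    ∃ λ i′ → i′ Fin.< i × napkinTaken (outcomeIn (claimsBefore f claimed i′) (f i′)) (f i′) ≡ just x
  claimsBefore-taken f claimed zero    x h = inj₁ h
  claimsBefore-taken f claimed (suc i) x h with claimsBefore-taken (f ∘ suc) (sit (f zero) claimed) i x h
  ... | inj₂ (i′ , i′<i , taken) = inj₂ (suc i′ , s≤s i′<i , taken)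
  ... | inj₁ h′ with grab-claimed (napkinTaken (outcomeIn claimed (f zero)) (f zero)) claimed x h′
  ...   | inj₁ h″    = inj₁ h″
  ...   | inj₂ taken = inj₂ (zero , s≤s z≤n , taken)

  before : Fin (suc m) → Claims
  before = claimsBefore id (λ _ → false)

  result : Fin (suc m) → Outcome
  result j = outcomeIn (before j) j

  taken-before : ∀ {k x} → before k x ≡ true → ∃ λ k′ → k′ Fin.< k × napkinTaken (result k′) k′ ≡ just x
  taken-before {k} {x} h with claimsBefore-taken id (λ _ → false) k x h
  ... | inj₂ taken = taken

  module Chase (σ′ : SignVec (suc m)) (near far : Fin (suc m) → Fin (suc m))
    (near-injective : ∀ {j k} → near j ≡ near k → j ≡ k)
    (preferred≡ : ∀ j → preferredNapkin j ≡ choose (σ′ j) (near j) (far j))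
    (other≡ : ∀ j → otherNapkin j ≡ choose (σ′ j) (far j) (near j)) where

    Yields : Fin (suc m) → Set
    Yields k = σ′ k ≡ Sign.+ × result k ≡ other

    TookFar : Fin (suc m) → Set
    TookFar k = Yields k ⊎ (σ′ k ≡ Sign.- × result k ≡ preferred)

    near≡ : ∀ k → near k ≡ choose (σ′ k) (preferredNapkin k) (otherNapkin k)
    near≡ k with σ′ k | preferred≡ k | other≡ k
    ... | Sign.+ | pref≡ | _    = sym pref≡
    ... | Sign.- | _     | oth≡ = sym oth≡

    near-claimed : ∀ k → result k ≡ napkinless ⊎ Yields k → before k (near k) ≡ true
    near-claimed k (inj₁ nl) = subst (λ x → before k x ≡ true) (sym (near≡ k))
      (choose-both {P = λ x → before k x ≡ true} (σ′ k) (proj₁ (outcome≡napkinless nl)) (proj₂ (outcome≡napkinless nl)))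
    near-claimed k (inj₂ (σ′k≡+ , oth)) = subst (λ x → before k x ≡ true)
      (sym (trans (near≡ k) (cong (λ s → choose s _ _) σ′k≡+))) (outcome≡other oth)

    taken-near-or-far : ∀ k {x} → napkinTaken (result k) k ≡ just x → x ≡ near k ⊎ (x ≡ far k × TookFar k)
    taken-near-or-far k {x} e with result k | σ′ k | preferred≡ k | other≡ k
    ... | preferred | Sign.+ | pref≡ | _    = inj₁ (trans (sym (just-injective e)) pref≡)
    ... | preferred | Sign.- | pref≡ | _    = inj₂ (trans (sym (just-injective e)) pref≡ , inj₂ (refl , refl))
    ... | other     | Sign.+ | _     | oth≡ = inj₂ (trans (sym (just-injective e)) oth≡ , inj₁ (refl , refl))
    ... | other     | Sign.- | _     | oth≡ = inj₁ (trans (sym (just-injective e)) oth≡)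

    -- An earlier diner took k's near napkin; by injectivity of near it was that diner's far napkin.
    earlier-far-taker : ∀ k → before k (near k) ≡ true →
                        ∃ λ k′ → k′ Fin.< k × far k′ ≡ near k × TookFar k′
    earlier-far-taker k h with taken-before h
    ... | k′ , k′<k , taken with taken-near-or-far k′ taken
    ...   | inj₁ near≡near       = ⊥-elim (ℕP.<-irrefl (cong toℕ (near-injective (sym near≡near))) k′<k)
    ...   | inj₂ (near≡far , tf) = k′ , k′<k , sym near≡far , tf

    data Chain (j : Fin (suc m)) : Fin (suc m) → Set where
      start : ∀ {k} → far k ≡ near j → Chain j k
      pass  : ∀ {y k} → Chain j y → Yields y → far k ≡ near y → Chain j k

    record Culprit (j : Fin (suc m)) : Set where
      field
        diner     : Fin (suc m)
        earlier   : diner Fin.< j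
        minus     : σ′ diner ≡ Sign.-
        satisfied : result diner ≡ preferred
        chain     : Chain j diner

    open Culprit

    chase : ∀ {j} k → Acc ℕ._<_ (toℕ k) → k Fin.< j → TookFar k → Chain j k → Culprit j
    chase k _ k<j (inj₂ (σ′k≡- , pref)) ch = record
      { diner = k ; earlier = k<j ; minus = σ′k≡- ; satisfied = pref ; chain = ch }
    chase k (acc rs) k<j (inj₁ yields) ch with earlier-far-taker k (near-claimed k (inj₂ yields))
    ... | k′ , k′<k , far≡near , tf =
      chase k′ (rs k′<k) (ℕP.<-trans k′<k k<j) tf (pass ch yields far≡near)

    culprit : ∀ j → result j ≡ napkinless → Culprit j
    culprit j nl with earlier-far-taker j (near-claimed j (inj₁ nl))
    ... | k , k<j , far≡near , tf = chase k (<-wellFounded (toℕ k)) k<j tf (start far≡near)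

    same-source : ∀ {x y k} → far k ≡ near x → far k ≡ near y → x ≡ y
    same-source e e′ = near-injective (trans (sym e) e′)

    chain-injective : ∀ {j j′ k} → Chain j k → Chain j′ k →
                      result j ≡ napkinless → result j′ ≡ napkinless → j ≡ j′
    chain-injective (start e) (start e′) _ _ = same-source e e′
    chain-injective (start e) (pass _ (_ , oth) e′) nl _ with same-source e e′
    ... | refl = contradiction (trans (sym nl) oth) λ ()
    chain-injective (pass _ (_ , oth) e) (start e′) _ nl′ with same-source e e′
    ... | refl = contradiction (trans (sym nl′) oth) λ ()
    chain-injective (pass ch _ e) (pass ch′ _ e′) nl nl′ with same-source e e′
    ... | refl = chain-injective ch ch′ nl nl′

    napkinless≢culprit : ∀ {j j′} → result j ≡ napkinless → (C : Culprit j′) → j ≢ diner C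
    napkinless≢culprit nl C refl = contradiction (trans (sym nl) (satisfied C)) λ ()

    napkinMatching : Matching σ′ (runDiners w σ (allFin (suc m)) (λ _ → false))
    napkinMatching with napkinlessList id (λ _ → false)
    ... | Zs , Zs! , len = record
      { pairs    = map (λ z → proj₁ z , partner z) Zs
      ; size     = trans (ListP.length-map _ Zs) len
      ; descents = AllP.map⁺ (All.universal (λ (j , nl) → earlier (culprit j nl) , minus (culprit j nl)) Zs)
      ; unique   = endpoints-unique proj₁ partner
                     (All.universal (λ (j , nl) → napkinless≢culprit nl (culprit j nl)) Zs)
                     (AllPairs.map apart Zs!)
      }
      where
      partner : ∃ (λ j → result j ≡ napkinless) → Fin (suc m)
      partner (j , nl) = diner (culprit j nl)
      apart : ∀ {x y} → proj₁ x ≢ proj₁ y → Apart proj₁ partner x y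
      apart {j , nl} {j′ , nl′} j≢j′ =
          j≢j′
        , napkinless≢culprit nl (culprit j′ nl′)
        , napkinless≢culprit nl′ (culprit j nl) ∘ sym
        , λ same → j≢j′ (chain-injective (chain (culprit j nl))
                           (subst (Chain j′) (sym same) (chain (culprit j′ nl′))) nl nl′)

  napkinMatching⁺ : Matching σ (runDiners w σ (allFin (suc m)) (λ _ → false))
  napkinMatching⁺ = Chase.napkinMatching σ seat (leftNapkin ∘ seat) seat-injective (λ _ → refl) (λ _ → refl)

  napkinMatching⁻ : Matching (negσ σ) (runDiners w σ (allFin (suc m)) (λ _ → false))
  napkinMatching⁻ = Chase.napkinMatching (negσ σ) (leftNapkin ∘ seat) seat
    (seat-injective ∘ leftNapkin-injective)
    (λ j → sym (choose-opposite (σ j) _ _)) (λ j → sym (choose-opposite (σ j) _ _))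

napkinMatchings : ∀ {m} (w : SeatingOrder m) (σ : SignVec (suc m)) →
                  Matching σ (ν w σ) × Matching (negσ σ) (ν w σ)
napkinMatchings (w , _) σ = Dinner.napkinMatching⁺ w σ , Dinner.napkinMatching⁻ w σ

+a-1≤+n-+c⇒a+c≤1+n : ∀ a c n → + a ℤ.- 1ℤ ℤ.≤ + n ℤ.- + c → a + c ≤ suc n
+a-1≤+n-+c⇒a+c≤1+n a c n h = ℤP.drop‿+≤+ (subst₂ ℤ._≤_ lhs rhs (ℤP.+-monoˡ-≤ (+ c ℤ.+ 1ℤ) h))
  where
  x-1+[y+1]≡x+y : ∀ (x y : ℤ) → (x ℤ.- 1ℤ) ℤ.+ (y ℤ.+ 1ℤ) ≡ x ℤ.+ y
  x-1+[y+1]≡x+y = solve-∀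
  x-y+[y+1]≡1+x : ∀ (x y : ℤ) → (x ℤ.- y) ℤ.+ (y ℤ.+ 1ℤ) ≡ 1ℤ ℤ.+ x
  x-y+[y+1]≡1+x = solve-∀
  lhs : (+ a ℤ.- 1ℤ) ℤ.+ (+ c ℤ.+ 1ℤ) ≡ + (a + c)
  lhs = trans (x-1+[y+1]≡x+y (+ a) (+ c)) (sym (ℤP.pos-+ a c))
  rhs : (+ n ℤ.- + c) ℤ.+ (+ c ℤ.+ 1ℤ) ≡ + suc n
  rhs = x-y+[y+1]≡1+x (+ n) (+ c)

2a≤1+2b⇒a≤b : ∀ {a b} → 2 * a ≤ suc (2 * b) → a ≤ b
2a≤1+2b⇒a≤b {a} {b} h = ℕP.≤-pred (ℕP.*-cancelˡ-< 2 a (suc b)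
  (subst (2 * a ℕ.<_) (sym (ℕP.*-suc 2 b)) (s≤s h)))

bound⇒i+k≤q : ∀ q r i k → + (q + r + 2 * i) ℤ.- 1ℤ ℤ.≤ + (r + q * 3) ℤ.- + (2 * k) → i + k ≤ q
bound⇒i+k≤q q r i k h = 2a≤1+2b⇒a≤b (ℕP.+-cancelˡ-≤ (q + r) _ _
  (subst₂ _≤_ (lhs q r i k) (rhs q r) (+a-1≤+n-+c⇒a+c≤1+n (q + r + 2 * i) (2 * k) (r + q * 3) h)))
  where
  lhs : ∀ q r i k → q + r + 2 * i + 2 * k ≡ (q + r) + 2 * (i + k)
  lhs = ℕSolver.solve-∀
  rhs : ∀ q r → suc (r + q * 3) ≡ (q + r) + suc (2 * q)
  rhs = ℕSolver.solve-∀

proposition4p2 : (m : ℕ) (σ : SignVec (suc m)) (i : ℕ) →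
    (+ (suc m / 3 ℕ.+ suc m % 3 ℕ.+ 2 ℕ.* i)) ℤ.- 1ℤ ℤ.≤ (drift σ ⊔ drift (negσ σ)) →
    ((β : BenchCollection (suc m)) →
      (i ≤ numUnbalanced β σ) × (numBalanced β σ ≤ suc m / 3 ∸ i))
    × ((w : SeatingOrder m) → ν w σ ≤ suc m / 3 ∸ i)
proposition4p2 m σ i hyp = benches , napkins
  where
  q : ℕ
  q = suc m / 3

  fits : ∀ {k} → Matching σ k → Matching (negσ σ) k → i + k ≤ q
  fits {k} M M⁻ = bound⇒i+k≤q q (suc m % 3) i k
    (subst (λ n → + (q + suc m % 3 + 2 * i) ℤ.- 1ℤ ℤ.≤ + n ℤ.- + (2 * k)) (m≡m%n+[m/n]*n (suc m) 3)
      (ℤP.≤-trans hyp (ℤP.⊔-lub (drift-≤-matching M) (drift-≤-matching M⁻))))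

  ≤q∸i : ∀ {k} → i + k ≤ q → k ≤ q ∸ i
  ≤q∸i {k} i+k≤q = ℕP.m+n≤o⇒m≤o∸n k (subst (_≤ q) (ℕP.+-comm i k) i+k≤q)

  benches : (β : BenchCollection (suc m)) → (i ≤ numUnbalanced β σ) × (numBalanced β σ ≤ q ∸ i)
  benches β = ℕP.+-cancelʳ-≤ k i _ (subst (i + k ≤_) (sym (unbalanced+balanced β σ)) i+k≤q) , ≤q∸i i+k≤q
    where
    k : ℕ
    k = numBalanced β σ
    i+k≤q : i + k ≤ q
    i+k≤q = fits (balancedMatching β σ (λ {B} → balanced⇒opposed σ B))
                 (balancedMatching β σ (λ {B} → cong opposite ∘ balanced⇒opposed σ B))

  napkins : (w : SeatingOrder m) → ν w σ ≤ q ∸ i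
  napkins w = ≤q∸i (fits (proj₁ (napkinMatchings w σ)) (proj₂ (napkinMatchings w σ)))
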